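{- For every $y\in\mathbb{F}_p^*$, the tiling $V_y$ is nonperiodic: there is no integer $m>0$ such that $V_y(n+m)=V_y(n)$ for all $n\in\mathbb{N}$.
   Context: Let $p$ be an odd prime, $\mathbb{F}_p$ the field with $p$ elements, $\mathbb{F}_p^*=\mathbb{F}_p\setminus\{0\}$. A tile $\square(x,y)$ is a unit segment whose left and right endpoints are decorated with $x,y\in\mathbb{F}_p$. The substitution $\tau$ maps $\square(x,y)$ to the sequence $\square(x,x+y)\,\square(x+y,y)$ and acts on sequences of tiles by concatenating images. Since $\tau(\square(0,y))$ begins with $\square(0,y)$, each $\tau^k(\square(0,y))$ is a prefix of $\tau^{k+1}(\square(0,y))$; $V_y$ is the infinite sequence of tiles that is the limit of $\tau^k(\square(0,y))$, and $V_y(n)$ denotes its $n$-th tile ($n\ge 0$). -}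

module Defs where

open import Data.Nat using (ℕ; zero; suc; _+_; _%_; NonZero)
open import Data.Nat.Primality using (Prime)
open import Data.Fin using (Fin; toℕ; fromℕ<)
open import Data.Fin as F using ()
open import Data.Nat.DivMod using (m%n<n)
open import Data.List using (List; []; _∷_; _++_; concatMap)
open import Data.Product using (_×_; _,_)
open import Function using (_∘_)

𝔽 : ℕ → Set
𝔽 p = Fin p

_+ₚ_ : {p : ℕ} → Fin p → Fin p → Fin p
_+ₚ_ {zero} ()
_+ₚ_ {suc q} x y = fromℕ< (m%n<n (toℕ x + toℕ y) (suc q))

zeroF : (p : ℕ) → .{{NonZero p}} → Fin p
zeroF (suc q) = F.zero

-- A tile □(x,y): left decoration x, right decoration y.
Tile : ℕ → Set
Tile p = Fin p × Fin p

τ₁ : {p : ℕ} → Tile p → List (Tile p)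
τ₁ (x , y) = (x , (x +ₚ y)) ∷ ((x +ₚ y) , y) ∷ []

τ : {p : ℕ} → List (Tile p) → List (Tile p)
τ = concatMap τ₁

iterate : {A : Set} → ℕ → (A → A) → A → A
iterate zero f a = a
iterate (suc k) f a = f (iterate k f a)

nth : {A : Set} → A → List A → ℕ → A
nth d [] n = d
nth d (a ∷ as) zero = a
nth d (a ∷ as) (suc n) = nth d as n

-- V_y(n): the n-th tile of the limit of τ^k(□(0,y)).
-- τ^(n+1)(□(0,y)) has length 2^(n+1) > n, and the τ^k(□(0,y)) are
-- nested prefixes, so its n-th tile is V_y(n) (the default is never used).
V : (p : ℕ) → .{{NonZero p}} → Fin p → ℕ → Tile p
V p y n = nth (zeroF p , y) (iterate (suc n) τ ((zeroF p , y) ∷ [])) n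

-- The substitution τ acts on V_y as a binary tree: τ^{k+1}(□(0,y)) is τ applied to
-- τ^k(□(0,y)), so V_y(2n) = □(x, x+y) and V_y(2n+1) = □(x+y, y) where V_y(n) = □(x,y).
-- Since V_y(n) is recovered from its two children, a period 2m halves to a period m.
-- An odd period 2k+1 instead matches the children of V_y(k+1) with V_y(1) = □(y,y) and
-- V_y(2) = □(y,2y), which forces y + 2y = y, i.e. 2y = 0; for an odd prime p and
-- y ≠ 0 this is impossible.
module Submission where

open import Defs
open import Data.Nat using (ℕ; zero; suc; _+_; _*_; _<_; _≤_; _≤′_; ≤′-refl; ≤′-step; z≤n; s≤s; z<s; NonZero)
open import Data.Nat.Base using (nonTrivial⇒n>1)
open import Data.Nat.Primality using (Prime; prime⇒nonTrivial; euclidsLemma)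
open import Data.Nat.Properties
open import Data.Nat.DivMod using (_%_; _/_; m%n<n; m<n⇒m%n≡m; m≡m%n+[m/n]*n)
open import Data.Nat.Divisibility using (_∣_; divides; ∣⇒≤; >⇒∤; m%n≡0⇒n∣m)
open import Data.Nat.Induction using (<-rec)
open import Data.Fin using (Fin; toℕ)
open import Data.Fin as F using ()
open import Data.Fin.Properties using (toℕ-fromℕ<; toℕ-injective; toℕ<n)
open import Data.List using (List; []; _∷_; _++_; length)
open import Data.List.Properties using (++-identityʳ; ++-assoc; concatMap-++)
open import Data.Product using (Σ; ∃-syntax; _×_; _,_; proj₁; proj₂)
open import Data.Sum using (_⊎_; inj₁; inj₂; [_,_]′)
open import Relation.Nullary using (¬_; contradiction)
open import Relation.Binary.PropositionalEquality
  using (_≡_; _≢_; refl; sym; trans; cong; cong₂; subst; module ≡-Reasoning)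

open ≡-Reasoning

toℕ-+ₚ : ∀ {p} .{{_ : NonZero p}} (x y : Fin p) → toℕ (x +ₚ y) ≡ (toℕ x + toℕ y) % p
toℕ-+ₚ {suc q} x y = toℕ-fromℕ< (m%n<n (toℕ x + toℕ y) (suc q))

+ₚ-identityˡ : ∀ {p} .{{_ : NonZero p}} (y : Fin p) → zeroF p +ₚ y ≡ y
+ₚ-identityˡ {suc q} y = toℕ-injective (trans (toℕ-+ₚ F.zero y) (m<n⇒m%n≡m (toℕ<n y)))

toℕ-zeroF : ∀ p .{{_ : NonZero p}} → toℕ (zeroF p) ≡ 0
toℕ-zeroF (suc _) = refl

∣toℕ⇒≡zero : ∀ {p} .{{_ : NonZero p}} (z : Fin p) → p ∣ toℕ z → z ≡ zeroF p
∣toℕ⇒≡zero {suc q} z p∣z with toℕ z in eq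
... | zero  = toℕ-injective eq
... | suc _ = contradiction p∣z (>⇒∤ (subst (_< suc q) eq (toℕ<n z)))

x+ₚz≡x⇒z≡0 : ∀ {p} .{{_ : NonZero p}} (x z : Fin p) → x +ₚ z ≡ x → z ≡ zeroF p
x+ₚz≡x⇒z≡0 {suc q} x z eq = ∣toℕ⇒≡zero z (divides k (+-cancelˡ-≡ a c (k * suc q) a+c≡a+kp))
  where
  a = toℕ x
  c = toℕ z
  k = (a + c) / suc q
  a+c≡a+kp : a + c ≡ a + k * suc q
  a+c≡a+kp = begin
    a + c                       ≡⟨ m≡m%n+[m/n]*n (a + c) (suc q) ⟩
    (a + c) % suc q + k * suc q ≡⟨ cong (_+ k * suc q) (trans (sym (toℕ-+ₚ x z)) (cong toℕ eq)) ⟩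
    a + k * suc q               ∎

prime∣2⇒≡2 : ∀ {p} → Prime p → p ∣ 2 → p ≡ 2
prime∣2⇒≡2 {p} pr p∣2 = ≤-antisym (∣⇒≤ p∣2) (nonTrivial⇒n>1 p {{prime⇒nonTrivial pr}})

y+ₚy≡0⇒y≡0 : ∀ {p} .{{_ : NonZero p}} → Prime p → p ≢ 2 →
             (y : Fin p) → y +ₚ y ≡ zeroF p → y ≡ zeroF p
y+ₚy≡0⇒y≡0 {p} pr p≢2 y 2y≡0 =
  [ (λ p∣2 → contradiction (prime∣2⇒≡2 pr p∣2) p≢2) , ∣toℕ⇒≡zero y ]′
    (euclidsLemma 2 (toℕ y) pr p∣2y)
  where
  p∣2y : p ∣ 2 * toℕ y
  p∣2y = m%n≡0⇒n∣m (2 * toℕ y) p (begin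
    (2 * toℕ y) % p       ≡⟨ cong (λ t → (toℕ y + t) % p) (+-identityʳ (toℕ y)) ⟩
    (toℕ y + toℕ y) % p   ≡⟨ sym (toℕ-+ₚ y y) ⟩
    toℕ (y +ₚ y)          ≡⟨ cong toℕ 2y≡0 ⟩
    toℕ (zeroF p)         ≡⟨ toℕ-zeroF p ⟩
    0                     ∎)

double : ℕ → ℕ
double zero    = zero
double (suc n) = suc (suc (double n))

double-+ : ∀ m n → double (m + n) ≡ double m + double n
double-+ zero    n = refl
double-+ (suc m) n = cong (λ t → suc (suc t)) (double-+ m n)

n≤double[n] : ∀ n → n ≤ double n
n≤double[n] zero    = z≤n
n≤double[n] (suc n) = s≤s (≤-trans (n≤double[n] n) (n≤1+n _))

m<n⇒1+double[m]<double[n] : ∀ {m n} → m < n → suc (double m) < double n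
m<n⇒1+double[m]<double[n] {zero}  {suc n} _         = s≤s (s≤s z≤n)
m<n⇒1+double[m]<double[n] {suc m} {suc n} (s≤s m<n) = s≤s (s≤s (m<n⇒1+double[m]<double[n] m<n))

even-or-odd : ∀ n → (∃[ k ] n ≡ double k) ⊎ (∃[ k ] n ≡ suc (double k))
even-or-odd zero = inj₁ (0 , refl)
even-or-odd (suc n) with even-or-odd n
... | inj₁ (k , n≡2k)   = inj₂ (k , cong suc n≡2k)
... | inj₂ (k , n≡2k+1) = inj₁ (suc k , cong suc n≡2k+1)

nth-++ˡ : ∀ {A : Set} (d : A) (l r : List A) {i} → i < length l → nth d (l ++ r) i ≡ nth d l i
nth-++ˡ d (a ∷ l) r {zero}  _         = refl
nth-++ˡ d (a ∷ l) r {suc i} (s≤s i<l) = nth-++ˡ d l r i<l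

_≼_ : {A : Set} → List A → List A → Set
l ≼ l′ = ∃[ r ] l′ ≡ l ++ r

≼-refl : ∀ {A : Set} (l : List A) → l ≼ l
≼-refl l = [] , sym (++-identityʳ l)

≼-trans : ∀ {A : Set} {l l′ l″ : List A} → l ≼ l′ → l′ ≼ l″ → l ≼ l″
≼-trans {l = l} (r , refl) (r′ , refl) = r ++ r′ , ++-assoc l r r′

nth-≼ : ∀ {A : Set} (d : A) {l l′ : List A} {i} → l ≼ l′ → i < length l → nth d l′ i ≡ nth d l i
nth-≼ d {l} (r , refl) = nth-++ˡ d l r

module _ {p : ℕ} where

  τˡ τʳ : Tile p → Tile p
  τˡ (x , y) = (x , x +ₚ y)
  τʳ (x , y) = (x +ₚ y , y)

  length-τ : (l : List (Tile p)) → length (τ l) ≡ double (length l)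
  length-τ []      = refl
  length-τ (t ∷ l) = cong (λ n → suc (suc n)) (length-τ l)

  τ-mono-≼ : {l l′ : List (Tile p)} → l ≼ l′ → τ l ≼ τ l′
  τ-mono-≼ {l} (r , refl) = τ r , concatMap-++ τ₁ l r

  nth-τ-double : ∀ d (l : List (Tile p)) {i} → i < length l →
                 nth d (τ l) (double i) ≡ τˡ (nth d l i)
  nth-τ-double d (t ∷ l) {zero}  _         = refl
  nth-τ-double d (t ∷ l) {suc i} (s≤s i<l) = nth-τ-double d l i<l

  nth-τ-suc-double : ∀ d (l : List (Tile p)) {i} → i < length l →
                     nth d (τ l) (suc (double i)) ≡ τʳ (nth d l i)
  nth-τ-suc-double d (t ∷ l) {zero}  _         = refl
  nth-τ-suc-double d (t ∷ l) {suc i} (s≤s i<l) = nth-τ-suc-double d l i<l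

module Tiling (p : ℕ) .{{_ : NonZero p}} (y : Fin p) where

  seed : Tile p
  seed = (zeroF p , y)

  T : ℕ → List (Tile p)
  T k = iterate k τ (seed ∷ [])

  T-≼-T-suc : ∀ k → T k ≼ T (suc k)
  T-≼-T-suc zero    = _ , cong (λ z → (zeroF p , z) ∷ (zeroF p +ₚ y , y) ∷ []) (+ₚ-identityˡ y)
  T-≼-T-suc (suc k) = τ-mono-≼ (T-≼-T-suc k)

  T-mono-≼ : ∀ {a b} → a ≤′ b → T a ≼ T b
  T-mono-≼ {a} ≤′-refl = ≼-refl (T a)
  T-mono-≼ {b = suc b} (≤′-step a≤b) = ≼-trans (T-mono-≼ a≤b) (T-≼-T-suc b)

  k<length-T : ∀ k → k < length (T k)
  k<length-T zero    = s≤s z≤n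
  k<length-T (suc k) = ≤-trans (s≤s (s≤s (n≤double[n] k)))
    (≤-trans (m<n⇒1+double[m]<double[n] (k<length-T k)) (≤-reflexive (sym (length-τ (T k)))))

  nth-T≡V : ∀ k {n} → n < length (T k) → nth seed (T k) n ≡ V p y n
  nth-T≡V k {n} n<T with ≤-total k (suc n)
  ... | inj₁ k≤1+n = sym (nth-≼ seed (T-mono-≼ (≤⇒≤′ k≤1+n)) n<T)
  ... | inj₂ 1+n≤k = nth-≼ seed (T-mono-≼ (≤⇒≤′ 1+n≤k)) (<-trans (n<1+n n) (k<length-T (suc n)))

  n<length-T[1+n] : ∀ n → n < length (T (suc n))
  n<length-T[1+n] n = <-trans (n<1+n n) (k<length-T (suc n))

  1+double[n]<length-T[2+n] : ∀ n → suc (double n) < length (T (suc (suc n)))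
  1+double[n]<length-T[2+n] n =
    ≤-trans (m<n⇒1+double[m]<double[n] (n<length-T[1+n] n))
            (≤-reflexive (sym (length-τ (T (suc n)))))

  V-double : ∀ n → V p y (double n) ≡ τˡ (V p y n)
  V-double n = begin
    V p y (double n)                      ≡⟨ nth-T≡V (suc (suc n)) (<-trans (n<1+n _) (1+double[n]<length-T[2+n] n)) ⟨
    nth seed (τ (T (suc n))) (double n)   ≡⟨ nth-τ-double seed (T (suc n)) (n<length-T[1+n] n) ⟩
    τˡ (V p y n)                          ∎

  V-suc-double : ∀ n → V p y (suc (double n)) ≡ τʳ (V p y n)
  V-suc-double n = begin
    V p y (suc (double n))                      ≡⟨ nth-T≡V (suc (suc n)) (1+double[n]<length-T[2+n] n) ⟨
    nth seed (τ (T (suc n))) (suc (double n))   ≡⟨ nth-τ-suc-double seed (T (suc n)) (n<length-T[1+n] n) ⟩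
    τʳ (V p y n)                                ∎

  V-children-injective : ∀ {a b} → V p y (double a) ≡ V p y (double b) →
                         V p y (suc (double a)) ≡ V p y (suc (double b)) → V p y a ≡ V p y b
  V-children-injective {a} {b} left right = cong₂ _,_
    (cong proj₁ (trans (sym (V-double a)) (trans left (V-double b))))
    (cong proj₂ (trans (sym (V-suc-double a)) (trans right (V-suc-double b))))

  Periodic : ℕ → Set
  Periodic m = (n : ℕ) → V p y (n + m) ≡ V p y n

  periodic-double⇒periodic : ∀ {m} → Periodic (double m) → Periodic m
  periodic-double⇒periodic {m} per n = V-children-injective {n + m} {n}
    (trans (cong (V p y) (double-+ n m)) (per (double n)))
    (trans (cong (λ t → V p y (suc t)) (double-+ n m)) (per (suc (double n))))

  V-1 : V p y 1 ≡ (y , y)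
  V-1 = begin
    V p y 1                     ≡⟨ V-suc-double 0 ⟩
    τʳ (zeroF p , zeroF p +ₚ y) ≡⟨ cong (λ z → τʳ (zeroF p , z)) (+ₚ-identityˡ y) ⟩
    (zeroF p +ₚ y , y)          ≡⟨ cong (_, y) (+ₚ-identityˡ y) ⟩
    (y , y)                     ∎

  V-2 : V p y 2 ≡ (y , y +ₚ y)
  V-2 = trans (V-double 1) (cong τˡ V-1)

  periodic-odd⇒y+ₚy≡0 : ∀ {k} → Periodic (suc (double k)) → y +ₚ y ≡ zeroF p
  periodic-odd⇒y+ₚy≡0 {k} per = x+ₚz≡x⇒z≡0 y (y +ₚ y) (begin
    y +ₚ (y +ₚ y) ≡⟨ cong₂ _+ₚ_ (sym (cong proj₁ left)) (sym (cong proj₂ right)) ⟩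
    a +ₚ b        ≡⟨ cong proj₂ left ⟩
    y             ∎)
    where
    a = proj₁ (V p y (suc k))
    b = proj₂ (V p y (suc k))
    -- 1 + (2k+1) and 2 + (2k+1) are definitionally double (k+1) and 1 + double (k+1).
    left : τˡ (V p y (suc k)) ≡ (y , y)
    left = trans (sym (V-double (suc k))) (trans (per 1) V-1)
    right : τʳ (V p y (suc k)) ≡ (y , y +ₚ y)
    right = trans (sym (V-suc-double (suc k))) (trans (per 2) V-2)

  no-positive-period : y +ₚ y ≢ zeroF p → ∀ m → 0 < m → ¬ Periodic m
  no-positive-period 2y≢0 = <-rec (λ m → 0 < m → ¬ Periodic m) step
    where
    step : ∀ m → (∀ {k} → k < m → 0 < k → ¬ Periodic k) → 0 < m → ¬ Periodic m
    step m rec m>0 per with even-or-odd m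
    ... | inj₁ (zero , refl)  = <-irrefl refl m>0
    ... | inj₁ (suc k , refl) =
      rec (s≤s (s≤s (n≤double[n] k))) z<s (periodic-double⇒periodic per)
    ... | inj₂ (k , refl)     = 2y≢0 (periodic-odd⇒y+ₚy≡0 per)

mainTheorem18 : (p : ℕ) → .{{_ : NonZero p}} → Prime p → p ≢ 2 →
    (y : Fin p) → y ≢ zeroF p →
    ¬ (Σ ℕ λ m → (0 < m) × ((n : ℕ) → V p y (n + m) ≡ V p y n))
mainTheorem18 p pr p≢2 y y≢0 (m , m>0 , per) =
  no-positive-period (λ 2y≡0 → y≢0 (y+ₚy≡0⇒y≡0 pr p≢2 y 2y≡0)) m m>0 per
  where open Tiling p y
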